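{- Exhaustive pure literal elimination is not symmetry-lifting: there exist CNF formulas $F$ and $F^*$ such that $F^*$ is obtained from $F$ by applying the pure literal rule until it is no longer applicable, and $\mathrm{Aut}_{\mathrm{sem}}(F^*)\uparrow^{\mathrm{Lit}(F)}\not\subseteq\mathrm{Aut}_{\mathrm{sem}}(F)$.
   Context: Literals: each variable $v$ gives literals $v,\bar v$ with $\bar{\bar v}=v$. A CNF formula $F$ is a finite set of clauses, each a finite set of literals; $\mathrm{Var}(F)$ is the set of variables occurring in $F$, $\mathrm{Lit}(F):=\mathrm{Var}(F)\cup\{\bar v:v\in\mathrm{Var}(F)\}$. An assignment of $F$ is a consistent map $\sigma:L\to\{\bot,\top\}$, $L\subseteq\mathrm{Lit}(F)$ ($\sigma(v)=\top$ iff $\sigma(\bar v)=\bot$), complete if $L=\mathrm{Lit}(F)$; write $l\in\sigma$ iff $\sigma(l)=\top$. For a formula $G$: $G[\sigma]:=\{C[\sigma]:C\in G,\ \nexists l\,(l\in\sigma\wedge l\in C)\}$ with $C[\sigma]:=\{l\in C:\bar l\notin\sigma\}$; $G[l\mapsto\top]$ is $G[\sigma]$ for $\sigma$ on $\{l,\bar l\}$ with $\sigma(l)=\top$. Bijections of literals act elementwise on clauses and formulas. A semantic symmetry of $F$ is a bijection $\varphi:\mathrm{Lit}(F)\to\mathrm{Lit}(F)$ with $\overline{\varphi(l)}=\varphi(\bar l)$ for all $l$ and $F[\sigma]=\varphi(F)[\sigma]$ for all complete assignments $\sigma$ of $F$; $\mathrm{Aut}_{\mathrm{sem}}(F)$ is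 the group of these. For a permutation group $\Gamma$ on $\Omega\subseteq\Omega'$, $\Gamma\uparrow^{\Omega'}$ consists of the extensions of each $\varphi\in\Gamma$ by the identity on $\Omega'\setminus\Omega$. Pure literal rule: if $l\in\mathrm{Lit}(F)$ is such that $\bar l\notin C$ for every $C\in F$, transform $F$ into $F[l\mapsto\top]$. -}

module Defs where

open import Data.Nat using (ℕ)
open import Data.Bool using (Bool; true; false; not; _∧_; _∨_)
open import Data.Maybe using (Maybe; just; nothing)
open import Data.List using (List; []; _∷_; map; filterᵇ)
open import Data.Bool.ListAction using (any)
open import Data.Nat using (_≟_)
open import Relation.Nullary using (yes; no)
open import Data.List.Membership.Propositional using (_∈_; _∉_)
open import Data.Product using (Σ; ∃; _×_; _,_)
open import Relation.Binary.PropositionalEquality using (_≡_; _≢_)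
open import Relation.Binary.Construct.Closure.ReflexiveTransitive using (Star)
open import Relation.Nullary using (¬_)
open import Function using (_⇔_)

data Literal : Set where
  pos : ℕ → Literal
  neg : ℕ → Literal

var : Literal → ℕ
var (pos v) = v
var (neg v) = v

~_ : Literal → Literal
~ pos v = neg v
~ neg v = pos v

-- clauses and formulas are finite sets, represented by lists (read up to
-- set equality, see _≈C_ and _≈F_ below)
Clause : Set
Clause = List Literal

Formula : Set
Formula = List Clause

_≈C_ : Clause → Clause → Set
C ≈C D = ∀ l → (l ∈ C) ⇔ (l ∈ D)

_≈F_ : Formula → Formula → Set
F ≈F G = (∀ C → C ∈ F → ∃ λ D → D ∈ G × C ≈C D)
       × (∀ D → D ∈ G → ∃ λ C → C ∈ F × C ≈C D)

_∈Var_ : ℕ → Formula → Set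
v ∈Var F = ∃ λ C → C ∈ F × ∃ λ l → l ∈ C × var l ≡ v

_∈Lit_ : Literal → Formula → Set
l ∈Lit F = var l ∈Var F

-- (partial) assignments: σ v = just b means σ(v) = b (so σ(v̄) = not b);
-- σ v = nothing means v is not in the domain.  Consistency is built in.
Assignment : Set
Assignment = ℕ → Maybe Bool

eqMB : Maybe Bool → Maybe Bool → Bool
eqMB (just true)  (just true)  = true
eqMB (just false) (just false) = true
eqMB nothing      nothing      = true
eqMB _            _            = false

polarity : Literal → Bool
polarity (pos _) = true
polarity (neg _) = false

trueIn : Assignment → Literal → Bool
trueIn σ l = eqMB (σ (var l)) (just (polarity l))

falseIn : Assignment → Literal → Bool
falseIn σ l = eqMB (σ (var l)) (just (not (polarity l)))

restrictC : Clause → Assignment → Clause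
restrictC C σ = filterᵇ (λ l → not (falseIn σ l)) C

restrict : Formula → Assignment → Formula
restrict G σ = map (λ C → restrictC C σ) (filterᵇ (λ C → not (any (trueIn σ) C)) G)

Complete : Formula → Assignment → Set
Complete F σ = ∀ v → (v ∈Var F → σ v ≢ nothing) × (σ v ≢ nothing → v ∈Var F)

single : Literal → Assignment
single (pos v) w with v ≟ w
... | yes _ = just true
... | no  _ = nothing
single (neg v) w with v ≟ w
... | yes _ = just false
... | no  _ = nothing

setTrue : Formula → Literal → Formula
setTrue F l = restrict F (single l)

act : (Literal → Literal) → Formula → Formula
act φ F = map (map φ) F

-- φ (a function on all literals; only its values on Lit(F) matter) is a
-- semantic symmetry of F: restricted to Lit(F) it is a bijection
-- Lit(F) → Lit(F), commutes with complementation, and F[σ] = φ(F)[σ]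
-- for all complete assignments σ of F.
IsSemSym : Formula → (Literal → Literal) → Set
IsSemSym F φ =
    (∀ l → l ∈Lit F → φ l ∈Lit F)
  × (∀ l l′ → l ∈Lit F → l′ ∈Lit F → φ l ≡ φ l′ → l ≡ l′)
  × (∀ l → l ∈Lit F → ∃ λ l′ → l′ ∈Lit F × φ l′ ≡ l)
  × (∀ l → l ∈Lit F → φ (~ l) ≡ ~ (φ l))
  × (∀ σ → Complete F σ → restrict F σ ≈F restrict (act φ F) σ)

Pure : Formula → Literal → Set
Pure F l = l ∈Lit F × (∀ C → C ∈ F → (~ l) ∉ C)

PureStep : Formula → Formula → Set
PureStep F G = ∃ λ l → Pure F l × G ≈F setTrue F l

PureExhaust : Formula → Formula → Set
PureExhaust F F* = Star PureStep F F* × (¬ ∃ λ l → Pure F* l)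

-- ψ is (a representative of) an element of Aut_sem(F*)↑^{Lit(F)}:
-- it agrees with some semantic symmetry of F* on Lit(F*) and is the
-- identity on Lit(F) ∖ Lit(F*).
InLiftedAut : Formula → Formula → (Literal → Literal) → Set
InLiftedAut F* F ψ =
  ∃ λ φ → IsSemSym F* φ
        × (∀ l → l ∈Lit F* → ψ l ≡ φ l)
        × (∀ l → l ∈Lit F → ¬ (l ∈Lit F*) → ψ l ≡ l)

-- The literal x₂ is pure, and eliminating it leaves
-- F* = {x₀ ∨ x₁, x̄₀ ∨ x̄₁}, which has no pure literal and is invariant under swapping
-- x₀ and x₁. Lifted to Lit(F), that swap fixes x₂, so it sends x₂ ∨ x₀ to x₂ ∨ x₁:
-- under x₀ = ⊤, x₁ = x₂ = ⊥ all of F is satisfied while the image contains a falsified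
-- clause, so the swap is not a semantic symmetry of F.
module Submission where

open import Defs
open import Data.Product using (∃; _×_; _,_; proj₁; proj₂)
open import Relation.Nullary using (¬_)

open import Data.Nat using (ℕ; suc)
open import Data.Bool using (Bool; true; false; not; _∨_)
open import Data.Maybe using (Maybe; just; nothing)
open import Data.List using ([]; _∷_; map)
open import Data.List.Relation.Unary.Any using (here; there)
open import Data.List.Membership.Propositional using (_∈_; _∉_)
open import Data.List.Membership.Propositional.Properties using (∈-map⁻)
open import Data.Bool.ListAction using (any)
open import Data.Sum using (_⊎_; inj₁; inj₂)
open import Data.Empty using (⊥-elim)
open import Function using (id; _∘_)
open import Function.Bundles using (mk⇔)
open import Relation.Binary.PropositionalEquality
  using (_≡_; refl; sym; cong; cong₂; subst; module ≡-Reasoning)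
open import Relation.Binary.Construct.Closure.ReflexiveTransitive using (ε; _◅_)

≡⇒≈F : ∀ {G H} → G ≡ H → G ≈F H
≡⇒≈F refl = (λ C C∈G → C , C∈G , λ _ → mk⇔ id id) , (λ D D∈G → D , D∈G , λ _ → mk⇔ id id)

renameLit : (ℕ → ℕ) → Literal → Literal
renameLit f (pos v) = pos (f v)
renameLit f (neg v) = neg (f v)

var-renameLit : ∀ f l → var (renameLit f l) ≡ f (var l)
var-renameLit f (pos v) = refl
var-renameLit f (neg v) = refl

renameLit-~ : ∀ f l → renameLit f (~ l) ≡ ~ renameLit f l
renameLit-~ f (pos v) = refl
renameLit-~ f (neg v) = refl

renameLit-involutive : ∀ {f} → (∀ v → f (f v) ≡ v) → ∀ l → renameLit f (renameLit f l) ≡ l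
renameLit-involutive inv (pos v) = cong pos (inv v)
renameLit-involutive inv (neg v) = cong neg (inv v)

∈Var-act-renameLit : ∀ {f v G} → v ∈Var act (renameLit f) G → ∃ λ u → u ∈Var G × v ≡ f u
∈Var-act-renameLit {f} (_ , fC∈fG , _ , fl∈fC , refl) with ∈-map⁻ (map (renameLit f)) fC∈fG
... | C , C∈G , refl with ∈-map⁻ (renameLit f) fl∈fC
...   | l , l∈C , refl = var l , (C , C∈G , l , l∈C , refl) , var-renameLit f l

restrictC-cong : ∀ {σ τ} C → (∀ l → l ∈ C → σ (var l) ≡ τ (var l)) → restrictC C σ ≡ restrictC C τ
restrictC-cong [] agree = refl
restrictC-cong {σ} {τ} (l ∷ C) agree
  with restrictC-cong {σ} {τ} C (λ l′ → agree l′ ∘ there)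
... | ih rewrite agree l (here refl) with not (falseIn τ l)
...   | true  = cong (l ∷_) ih
...   | false = ih

any-trueIn-cong : ∀ {σ τ} C → (∀ l → l ∈ C → σ (var l) ≡ τ (var l)) → any (trueIn σ) C ≡ any (trueIn τ) C
any-trueIn-cong [] agree = refl
any-trueIn-cong {σ} {τ} (l ∷ C) agree =
  cong₂ _∨_ (cong (λ b → eqMB b (just (polarity l))) (agree l (here refl)))
            (any-trueIn-cong {σ} {τ} C (λ l′ → agree l′ ∘ there))

∈Var-head : ∀ {l C G} → l ∈ C → var l ∈Var (C ∷ G)
∈Var-head l∈C = _ , here refl , _ , l∈C , refl

∈Var-tail : ∀ {v C G} → v ∈Var G → v ∈Var (C ∷ G)
∈Var-tail (D , D∈G , rest) = D , there D∈G , rest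

restrict-cong : ∀ {σ τ} G → (∀ v → v ∈Var G → σ v ≡ τ v) → restrict G σ ≡ restrict G τ
restrict-cong [] agree = refl
restrict-cong {σ} {τ} (C ∷ G) agree
  with any (trueIn σ) C | any (trueIn τ) C | any-trueIn-cong {σ} {τ} C (λ l → agree (var l) ∘ ∈Var-head)
... | true  | .true  | refl = restrict-cong {σ} {τ} G (λ v → agree v ∘ ∈Var-tail)
... | false | .false | refl = cong₂ _∷_ (restrictC-cong {σ} {τ} C (λ l → agree (var l) ∘ ∈Var-head))
                                        (restrict-cong {σ} {τ} G (λ v → agree v ∘ ∈Var-tail))

renameLit-isSemSym : ∀ {G f} → (∀ v → f (f v) ≡ v) → (∀ v → v ∈Var G → f v ∈Var G)
                   → (∀ σ → Complete G σ → restrict G σ ≡ restrict (act (renameLit f) G) σ)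
                   → IsSemSym G (renameLit f)
renameLit-isSemSym {G} {f} inv closed sem =
  lit-closed , injective , surjective , (λ l _ → renameLit-~ f l) , λ σ c → ≡⇒≈F (sem σ c)
  where
  lit-closed : ∀ l → l ∈Lit G → renameLit f l ∈Lit G
  lit-closed l l∈G = subst (_∈Var G) (sym (var-renameLit f l)) (closed (var l) l∈G)

  injective : ∀ l l′ → l ∈Lit G → l′ ∈Lit G → renameLit f l ≡ renameLit f l′ → l ≡ l′
  injective l l′ _ _ e = begin
    l                             ≡⟨ sym (renameLit-involutive inv l) ⟩
    renameLit f (renameLit f l)   ≡⟨ cong (renameLit f) e ⟩
    renameLit f (renameLit f l′)  ≡⟨ renameLit-involutive inv l′ ⟩
    l′                            ∎
    where open ≡-Reasoning

  surjective : ∀ l → l ∈Lit G → ∃ λ l′ → l′ ∈Lit G × renameLit f l′ ≡ l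
  surjective l l∈G = renameLit f l , lit-closed l l∈G , renameLit-involutive inv l

F* : Formula
F* = (pos 0 ∷ pos 1 ∷ []) ∷ (neg 0 ∷ neg 1 ∷ []) ∷ []

F : Formula
F = (pos 0 ∷ pos 1 ∷ []) ∷ (neg 0 ∷ neg 1 ∷ []) ∷ (pos 2 ∷ pos 0 ∷ []) ∷ []

0∈VarF* : 0 ∈Var F*
0∈VarF* = _ , here refl , pos 0 , here refl , refl

1∈VarF* : 1 ∈Var F*
1∈VarF* = _ , here refl , pos 1 , there (here refl) , refl

∈VarF*⇒ : ∀ {v} → v ∈Var F* → v ≡ 0 ⊎ v ≡ 1
∈VarF*⇒ (_ , here refl         , _ , here refl         , refl) = inj₁ refl
∈VarF*⇒ (_ , here refl         , _ , there (here refl) , refl) = inj₂ refl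
∈VarF*⇒ (_ , there (here refl) , _ , here refl         , refl) = inj₁ refl
∈VarF*⇒ (_ , there (here refl) , _ , there (here refl) , refl) = inj₂ refl

∈VarF⇒ : ∀ {v} → v ∈Var F → v ≡ 0 ⊎ v ≡ 1 ⊎ v ≡ 2
∈VarF⇒ (_ , here refl                 , _ , here refl         , refl) = inj₁ refl
∈VarF⇒ (_ , here refl                 , _ , there (here refl) , refl) = inj₂ (inj₁ refl)
∈VarF⇒ (_ , there (here refl)         , _ , here refl         , refl) = inj₁ refl
∈VarF⇒ (_ , there (here refl)         , _ , there (here refl) , refl) = inj₂ (inj₁ refl)
∈VarF⇒ (_ , there (there (here refl)) , _ , here refl         , refl) = inj₂ (inj₂ refl)
∈VarF⇒ (_ , there (there (here refl)) , _ , there (here refl) , refl) = inj₁ refl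

x₂-pure : Pure F (pos 2)
x₂-pure = (_ , there (there (here refl)) , pos 2 , here refl , refl) , x̄₂∉
  where
  x̄₂∉ : ∀ C → C ∈ F → neg 2 ∉ C
  x̄₂∉ _ (here refl)                  (here ())
  x̄₂∉ _ (here refl)                  (there (here ()))
  x̄₂∉ _ (there (here refl))          (here ())
  x̄₂∉ _ (there (here refl))          (there (here ()))
  x̄₂∉ _ (there (there (here refl))) (here ())
  x̄₂∉ _ (there (there (here refl))) (there (here ()))

F*-has-no-pure-literal : ¬ ∃ λ l → Pure F* l
F*-has-no-pure-literal (pos v , v∈F* , ~l∉) with ∈VarF*⇒ v∈F*
... | inj₁ refl = ~l∉ _ (there (here refl)) (here refl)
... | inj₂ refl = ~l∉ _ (there (here refl)) (there (here refl))
F*-has-no-pure-literal (neg v , v∈F* , ~l∉) with ∈VarF*⇒ v∈F*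
... | inj₁ refl = ~l∉ _ (here refl) (here refl)
... | inj₂ refl = ~l∉ _ (here refl) (there (here refl))

F*-exhausts-F : PureExhaust F F*
F*-exhausts-F = (pos 2 , x₂-pure , ≡⇒≈F refl) ◅ ε , F*-has-no-pure-literal

swap₀₁ : ℕ → ℕ
swap₀₁ 0 = 1
swap₀₁ 1 = 0
swap₀₁ v = v

swap₀₁-involutive : ∀ v → swap₀₁ (swap₀₁ v) ≡ v
swap₀₁-involutive 0 = refl
swap₀₁-involutive 1 = refl
swap₀₁-involutive (suc (suc v)) = refl

ψ : Literal → Literal
ψ = renameLit swap₀₁

swap₀₁-closed-F* : ∀ v → v ∈Var F* → swap₀₁ v ∈Var F*
swap₀₁-closed-F* v v∈F* with ∈VarF*⇒ v∈F*
... | inj₁ refl = 1∈VarF*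
... | inj₂ refl = 0∈VarF*

≢nothing⇒just : ∀ {m : Maybe Bool} → ¬ m ≡ nothing → ∃ λ b → m ≡ just b
≢nothing⇒just {just b} _ = b , refl
≢nothing⇒just {nothing} m≢nothing = ⊥-elim (m≢nothing refl)

assign₀₁ : Bool → Bool → Assignment
assign₀₁ a b 0 = just a
assign₀₁ a b 1 = just b
assign₀₁ a b _ = nothing

ψ-invariant-F* : ∀ a b → restrict F* (assign₀₁ a b) ≡ restrict (act ψ F*) (assign₀₁ a b)
ψ-invariant-F* true  true  = refl
ψ-invariant-F* true  false = refl
ψ-invariant-F* false true  = refl
ψ-invariant-F* false false = refl

ψ-isSemSym-F* : IsSemSym F* ψ
ψ-isSemSym-F* = renameLit-isSemSym swap₀₁-involutive swap₀₁-closed-F* sem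
  where
  sem : ∀ σ → Complete F* σ → restrict F* σ ≡ restrict (act ψ F*) σ
  sem σ complete
    with ≢nothing⇒just (proj₁ (complete 0) 0∈VarF*) | ≢nothing⇒just (proj₁ (complete 1) 1∈VarF*)
  ... | a , σ0 | b , σ1 = begin
    restrict F* σ                          ≡⟨ restrict-cong F* agree ⟩
    restrict F* (assign₀₁ a b)             ≡⟨ ψ-invariant-F* a b ⟩
    restrict (act ψ F*) (assign₀₁ a b)     ≡⟨ sym (restrict-cong (act ψ F*) agree-ψ) ⟩
    restrict (act ψ F*) σ                  ∎
    where
    open ≡-Reasoning
    agree : ∀ v → v ∈Var F* → σ v ≡ assign₀₁ a b v
    agree v v∈F* with ∈VarF*⇒ v∈F*
    ... | inj₁ refl = σ0
    ... | inj₂ refl = σ1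
    agree-ψ : ∀ v → v ∈Var act ψ F* → σ v ≡ assign₀₁ a b v
    agree-ψ v v∈ψF* with ∈Var-act-renameLit {swap₀₁} v∈ψF*
    ... | u , u∈F* , refl = agree (swap₀₁ u) (swap₀₁-closed-F* u u∈F*)

ψ-lifts : InLiftedAut F* F ψ
ψ-lifts = ψ , ψ-isSemSym-F* , (λ _ _ → refl) , fixes-outside
  where
  fixes-outside : ∀ l → l ∈Lit F → ¬ (l ∈Lit F*) → ψ l ≡ l
  fixes-outside (pos 0) _ l∉F* = ⊥-elim (l∉F* 0∈VarF*)
  fixes-outside (pos 1) _ l∉F* = ⊥-elim (l∉F* 1∈VarF*)
  fixes-outside (pos (suc (suc v))) _ _ = refl
  fixes-outside (neg 0) _ l∉F* = ⊥-elim (l∉F* 0∈VarF*)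
  fixes-outside (neg 1) _ l∉F* = ⊥-elim (l∉F* 1∈VarF*)
  fixes-outside (neg (suc (suc v))) _ _ = refl

σ₀ : Assignment
σ₀ 0 = just true
σ₀ 1 = just false
σ₀ 2 = just false
σ₀ _ = nothing

σ₀-complete-F : Complete F σ₀
σ₀-complete-F v = defined v , in-domain v
  where
  defined : ∀ v → v ∈Var F → ¬ σ₀ v ≡ nothing
  defined v v∈F with ∈VarF⇒ v∈F
  ... | inj₁ refl        = λ ()
  ... | inj₂ (inj₁ refl) = λ ()
  ... | inj₂ (inj₂ refl) = λ ()
  in-domain : ∀ v → ¬ σ₀ v ≡ nothing → v ∈Var F
  in-domain 0 _ = _ , here refl , pos 0 , here refl , refl
  in-domain 1 _ = _ , here refl , pos 1 , there (here refl) , refl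
  in-domain 2 _ = _ , there (there (here refl)) , pos 2 , here refl , refl
  in-domain (suc (suc (suc v))) undefined = ⊥-elim (undefined refl)

-- F[σ₀] is empty, whereas ψ(F)[σ₀] contains the empty clause.
ψ-not-isSemSym-F : ¬ IsSemSym F ψ
ψ-not-isSemSym-F (_ , _ , _ , _ , sem) with proj₂ (sem σ₀ σ₀-complete-F) [] (here refl)
... | _ , () , _

corollary1 : ∃ λ F → ∃ λ F* → PureExhaust F F* × ∃ λ ψ → InLiftedAut F* F ψ × ¬ IsSemSym F ψ
corollary1 = F , F* , F*-exhausts-F , ψ , ψ-lifts , ψ-not-isSemSym-F
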